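{- For $n\ge 1$ and all integers $k$, the numbers $\widehat{A}_{n,k}$ satisfy $$2\widehat{A}_{n+1,k}=(k+1)(\widehat{A}_{n,k+1}+\widehat{A}_{n,k-1})+(n-k+1)(\widehat{A}_{n,k}+\widehat{A}_{n,k-2}),$$ with initial conditions $\widehat{A}_{1,0}=1$ and $\widehat{A}_{1,k}=0$ for $k\ne 0$.
   Context: For $\pi=\pi_1\cdots\pi_n\in\mathfrak{S}_n$ (permutations of $\{1,\dots,n\}$), the alternating descent set is $\widehat{D}(\pi)=\{2i\in[n-1]: \pi_{2i}<\pi_{2i+1}\}\cup\{2i+1\in[n-1]: \pi_{2i+1}>\pi_{2i+2}\}$ and $\mathrm{altdes}(\pi)=|\widehat{D}(\pi)|$. $\widehat{A}_{n,k}$ is the number of $\pi\in\mathfrak{S}_n$ with $\mathrm{altdes}(\pi)=k$ (so $\widehat{A}_{n,k}=0$ for $k<0$ or $k>n-1$). -}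

module Defs where

open import Data.Bool using (Bool; true; false; if_then_else_)
open import Data.Nat using (ℕ; zero; suc; _+_; _<ᵇ_)
open import Data.Fin using (Fin; toℕ)
open import Data.Fin.Properties using (_≟_)
open import Data.List using (List; []; _∷_; map; concatMap; filter; length; allFin)
open import Data.Vec using (Vec; []; _∷_; toList)
open import Data.Integer using (ℤ; +_)
import Data.Integer.Properties as ℤP
import Data.List.Relation.Unary.Unique.DecPropositional as UniqueDec
open import Relation.Binary.PropositionalEquality using (_≡_)

words : (n m : ℕ) → List (Vec (Fin m) n)
words zero    m = [] ∷ []
words (suc n) m = concatMap (λ i → map (i ∷_) (words n m)) (allFin m)

-- The symmetric group S_n: all injective words of length n over Fin n
-- (values 0..n-1 stand for 1..n; only the relative order matters).
perms : (n : ℕ) → List (Vec (Fin n) n)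
perms n = filter (λ v → UniqueDec.unique? (_≟_ {n}) (toList v)) (words n n)

isEven : ℕ → Bool
isEven zero          = true
isEven (suc zero)    = false
isEven (suc (suc i)) = isEven i

toNat : Bool → ℕ
toNat true  = 1
toNat false = 0

altdesFrom : ℕ → List ℕ → ℕ
altdesFrom i (x ∷ y ∷ r) =
  toNat (if isEven i then x <ᵇ y else y <ᵇ x) + altdesFrom (suc i) (y ∷ r)
altdesFrom i _ = 0

altdes : {n : ℕ} → Vec (Fin n) n → ℕ
altdes π = altdesFrom 1 (map toℕ (toList π))

Ahat : ℕ → ℤ → ℤ
Ahat n k = + length (filter (λ π → (+ altdes π) ℤP.≟ k) (perms n))

-- Encode a permutation π of [n] by its code c, where cᵢ is the rank of πᵢ among
-- πᵢ, …, πₙ (decode inverts this). Since πᵢ > πᵢ₊₁ iff cᵢ > cᵢ₊₁, Â_{n,k} counts codes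
-- with k alternating descents. A code of length n+1 arises in exactly one way from a
-- code of length n and a position j by putting the largest admissible value at j and
-- complementing the entries after j; likewise with the smallest value. Complementing
-- turns the descents of the tail into ascents, which compensates for the shift of its
-- parity, so only the comparisons next to j change altdes. Among the 2(n+1) insertions
-- into a code with altdes a, the values a-1, a, a+1, a+2 occur a, n+1-a, a+2 and n-1-a
-- times; summing over all codes gives the recurrence.
module Submission where

open import Defs
open import Data.Bool using (Bool; true; false; if_then_else_; not; _∧_; _xor_)
open import Data.Bool.Properties using (not-distribˡ-xor; not-distribʳ-xor)
open import Data.Nat as ℕ using (ℕ; zero; suc; pred; _≤_; _<ᵇ_)
open import Data.Fin using (Fin; zero; suc; toℕ; fromℕ; inject₁; opposite; punchIn)
open import Data.Fin.Properties using (_≟_; toℕ-inject₁; punchIn-injective)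
open import Data.List using (List; []; _∷_; _++_; map; concat; filter; length; tabulate; allFin)
open import Data.List.Relation.Unary.All using (all?)
open import Data.List.Relation.Unary.Unique.Propositional using (Unique)
import Data.List.Relation.Unary.Unique.Propositional.Properties as Unique
import Data.List.Relation.Unary.Unique.DecPropositional as UniqueDec
open import Data.Vec as Vec using (Vec; []; _∷_; toList)
open import Data.Vec.Properties using (toList-map)
open import Data.Integer using (ℤ; +_; _+_; _-_; _*_)
import Data.Integer.Properties as ℤ
open import Data.Integer.Tactic.RingSolver using (solve-∀)
open import Algebra.Properties.Semiring.Sum ℤ.+-*-semiring
  using (sum; sum-syntax; sum-cong-≗; ∑-distrib-+; ∑-comm; sum-init-last; *-distribˡ-sum; sum-replicate-zero)
open import Data.Product using (_×_; _,_)
open import Function using (_∘_; mk⇔)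
open import Relation.Unary using (Decidable)
open import Relation.Nullary using (does; yes; no; ¬?)
open import Relation.Nullary.Decidable using (does-⇔; dec-false)
open import Relation.Binary.PropositionalEquality

private variable
  A B : Set
  m n : ℕ

∑ˡ : List A → (A → ℤ) → ℤ
∑ˡ []       G = + 0
∑ˡ (x ∷ xs) G = G x + ∑ˡ xs G

∑ˡ-++ : (xs ys : List A) (G : A → ℤ) → ∑ˡ (xs ++ ys) G ≡ ∑ˡ xs G + ∑ˡ ys G
∑ˡ-++ []       ys G = sym (ℤ.+-identityˡ _)
∑ˡ-++ (x ∷ xs) ys G = trans (cong (_+_ (G x)) (∑ˡ-++ xs ys G)) (sym (ℤ.+-assoc (G x) _ _))

∑ˡ-concat : (xss : List (List A)) (G : A → ℤ) → ∑ˡ (concat xss) G ≡ ∑ˡ xss (λ xs → ∑ˡ xs G)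
∑ˡ-concat []         G = refl
∑ˡ-concat (xs ∷ xss) G = trans (∑ˡ-++ xs (concat xss) G) (cong (_+_ (∑ˡ xs G)) (∑ˡ-concat xss G))

∑ˡ-map : (f : A → B) (xs : List A) (G : B → ℤ) → ∑ˡ (map f xs) G ≡ ∑ˡ xs (G ∘ f)
∑ˡ-map f []       G = refl
∑ˡ-map f (x ∷ xs) G = cong (_+_ (G (f x))) (∑ˡ-map f xs G)

∑ˡ-tabulate : (f : Fin n → A) (G : A → ℤ) → ∑ˡ (tabulate f) G ≡ ∑[ i < n ] G (f i)
∑ˡ-tabulate {n = zero}  f G = refl
∑ˡ-tabulate {n = suc n} f G = cong (_+_ (G (f zero))) (∑ˡ-tabulate (f ∘ suc) G)

∑ˡ-filter : {P : A → Set} (P? : Decidable P) (xs : List A) (G : A → ℤ) →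
            ∑ˡ (filter P? xs) G ≡ ∑ˡ xs (λ x → if does (P? x) then G x else + 0)
∑ˡ-filter P? []       G = refl
∑ˡ-filter P? (x ∷ xs) G with does (P? x)
... | true  = cong (_+_ (G x)) (∑ˡ-filter P? xs G)
... | false = trans (∑ˡ-filter P? xs G) (sym (ℤ.+-identityˡ _))

length-filter : {P : A → Set} (P? : Decidable P) (xs : List A) →
                + length (filter P? xs) ≡ ∑ˡ xs (λ x → if does (P? x) then + 1 else + 0)
length-filter P? []       = refl
length-filter P? (x ∷ xs) with does (P? x)
... | true  = cong (_+_ (+ 1)) (length-filter P? xs)
... | false = trans (length-filter P? xs) (sym (ℤ.+-identityˡ _))

∑ʷ : ∀ m n → (Vec (Fin n) m → ℤ) → ℤ
∑ʷ zero    n G = G []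
∑ʷ (suc m) n G = ∑[ i < n ] ∑ʷ m n (λ w → G (i ∷ w))

∑ˡ-words : ∀ m n (G : Vec (Fin n) m → ℤ) → ∑ˡ (words m n) G ≡ ∑ʷ m n G
∑ˡ-words zero    n G = ℤ.+-identityʳ (G [])
∑ˡ-words (suc m) n G = begin
    ∑ˡ (concat (map (λ i → map (i ∷_) (words m n)) (allFin n))) G
  ≡⟨ ∑ˡ-concat (map (λ i → map (i ∷_) (words m n)) (allFin n)) G ⟩
    ∑ˡ (map (λ i → map (i ∷_) (words m n)) (allFin n)) (λ ws → ∑ˡ ws G)
  ≡⟨ ∑ˡ-map (λ i → map (i ∷_) (words m n)) (allFin n) (λ ws → ∑ˡ ws G) ⟩
    ∑ˡ (allFin n) (λ i → ∑ˡ (map (i ∷_) (words m n)) G)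
  ≡⟨ ∑ˡ-tabulate (λ i → i) (λ i → ∑ˡ (map (i ∷_) (words m n)) G) ⟩
    ∑[ i < n ] ∑ˡ (map (i ∷_) (words m n)) G
  ≡⟨ sum-cong-≗ (λ i → trans (∑ˡ-map (i ∷_) (words m n) G) (∑ˡ-words m n (G ∘ (i ∷_)))) ⟩
    ∑[ i < n ] ∑ʷ m n (G ∘ (i ∷_))
  ∎
  where open ≡-Reasoning

∑ʷ-cong : ∀ m n {G H : Vec (Fin n) m → ℤ} → (∀ w → G w ≡ H w) → ∑ʷ m n G ≡ ∑ʷ m n H
∑ʷ-cong zero    n G≗H = G≗H []
∑ʷ-cong (suc m) n G≗H = sum-cong-≗ (λ i → ∑ʷ-cong m n (G≗H ∘ (i ∷_)))

∑ʷ-zero : ∀ m n → ∑ʷ m n (λ _ → + 0) ≡ + 0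
∑ʷ-zero zero    n = refl
∑ʷ-zero (suc m) n = trans (sum-cong-≗ {n} (λ _ → ∑ʷ-zero m n)) (sum-replicate-zero n)

∑ʷ-if : ∀ m n b (G : Vec (Fin n) m → ℤ) →
        ∑ʷ m n (λ w → if b then G w else + 0) ≡ (if b then ∑ʷ m n G else + 0)
∑ʷ-if m n true  G = refl
∑ʷ-if m n false G = ∑ʷ-zero m n

if-∧ : ∀ a b (x : ℤ) → (if a ∧ b then x else + 0) ≡ (if a then (if b then x else + 0) else + 0)
if-∧ true  b x = refl
if-∧ false b x = refl

∑-punchIn : ∀ (x : Fin (suc n)) (g : Fin (suc n) → ℤ) →
            ∑[ i < suc n ] (if not (does (x ≟ i)) then g i else + 0) ≡ ∑[ i < n ] g (punchIn x i)
∑-punchIn             zero    g = ℤ.+-identityˡ _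
∑-punchIn {n = suc n} (suc x) g = cong (_+_ (g zero)) (∑-punchIn x (g ∘ suc))

avoids : Fin n → Vec (Fin n) m → Bool
avoids x w = does (all? (λ y → ¬? (x ≟ y)) (toList w))

∑ʷ-avoids : ∀ m (x : Fin (suc n)) (G : Vec (Fin (suc n)) m → ℤ) →
            ∑ʷ m (suc n) (λ w → if avoids x w then G w else + 0) ≡ ∑ʷ m n (G ∘ Vec.map (punchIn x))
∑ʷ-avoids zero    x G = refl
∑ʷ-avoids {n = n} (suc m) x G = begin
    ∑[ i < suc n ] ∑ʷ m (suc n) (λ w → if not (does (x ≟ i)) ∧ avoids x w then G (i ∷ w) else + 0)
  ≡⟨ sum-cong-≗ (λ i → trans (∑ʷ-cong m (suc n) (λ w → if-∧ (not (does (x ≟ i))) (avoids x w) (G (i ∷ w))))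
                             (∑ʷ-if m (suc n) (not (does (x ≟ i))) (avoiding i))) ⟩
    ∑[ i < suc n ] (if not (does (x ≟ i))
                    then ∑ʷ m (suc n) (λ w → if avoids x w then G (i ∷ w) else + 0) else + 0)
  ≡⟨ ∑-punchIn x (λ i → ∑ʷ m (suc n) (avoiding i)) ⟩
    ∑[ i < n ] ∑ʷ m (suc n) (λ w → if avoids x w then G (punchIn x i ∷ w) else + 0)
  ≡⟨ sum-cong-≗ (λ i → ∑ʷ-avoids m x (G ∘ (punchIn x i ∷_))) ⟩
    ∑[ i < n ] ∑ʷ m n (λ w → G (punchIn x i ∷ Vec.map (punchIn x) w))
  ∎
  where
  open ≡-Reasoning
  avoiding : Fin (suc n) → Vec (Fin (suc n)) m → ℤ
  avoiding i w = if avoids x w then G (i ∷ w) else + 0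

unique : Vec (Fin n) m → Bool
unique w = does (UniqueDec.unique? _≟_ (toList w))

unique-punchIn : ∀ (x : Fin (suc n)) (w : Vec (Fin n) m) → unique (Vec.map (punchIn x) w) ≡ unique w
unique-punchIn x w = does-⇔ (mk⇔ forget remember) (UniqueDec.unique? _≟_ _) (UniqueDec.unique? _≟_ _)
  where
  forget : Unique (toList (Vec.map (punchIn x) w)) → Unique (toList w)
  forget u = Unique.map⁻ (subst Unique (toList-map (punchIn x) w) u)
  remember : Unique (toList w) → Unique (toList (Vec.map (punchIn x) w))
  remember u = subst Unique (sym (toList-map (punchIn x) w)) (Unique.map⁺ (λ {a} {b} → punchIn-injective x a b) u)

data Code : ℕ → Set where
  []  : Code zero
  _∷_ : Fin (suc n) → Code n → Code (suc n)

∑code : ∀ n → (Code n → ℤ) → ℤ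
∑code zero    G = G []
∑code (suc n) G = ∑[ x < suc n ] ∑code n (λ c → G (x ∷ c))

decode : Code n → Vec (Fin n) n
decode []      = []
decode (x ∷ c) = x ∷ Vec.map (punchIn x) (decode c)

∑-permutations : ∀ n (G : Vec (Fin n) n → ℤ) →
                 ∑ʷ n n (λ w → if unique w then G w else + 0) ≡ ∑code n (G ∘ decode)
∑-permutations zero    G = refl
∑-permutations (suc n) G = sum-cong-≗ (λ x → begin
    ∑ʷ n (suc n) (λ w → if avoids x w ∧ unique w then G (x ∷ w) else + 0)
  ≡⟨ ∑ʷ-cong n (suc n) (λ w → if-∧ (avoids x w) (unique w) (G (x ∷ w))) ⟩
    ∑ʷ n (suc n) (λ w → if avoids x w then (if unique w then G (x ∷ w) else + 0) else + 0)
  ≡⟨ ∑ʷ-avoids n x (λ w → if unique w then G (x ∷ w) else + 0) ⟩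
    ∑ʷ n n (λ w → if unique (Vec.map (punchIn x) w) then G (x ∷ Vec.map (punchIn x) w) else + 0)
  ≡⟨ ∑ʷ-cong n n (λ w → cong (λ b → if b then G (x ∷ Vec.map (punchIn x) w) else + 0) (unique-punchIn x w)) ⟩
    ∑ʷ n n (λ w → if unique w then G (x ∷ Vec.map (punchIn x) w) else + 0)
  ≡⟨ ∑-permutations n (λ w → G (x ∷ Vec.map (punchIn x) w)) ⟩
    ∑code n (λ c → G (decode (x ∷ c)))
  ∎)
  where open ≡-Reasoning

_<ᶠ_ : Fin m → Fin n → Bool
i <ᶠ j = toℕ i <ᵇ toℕ j

-- e is the parity of the first position (true = even): an even position counts an
-- ascent, an odd one a descent y <ᶠ x.
altdesᶜ : Bool → Code n → ℕ
altdesᶜ e []          = 0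
altdesᶜ e (x ∷ [])    = 0
altdesᶜ e (x ∷ y ∷ c) = toNat (e xor (y <ᶠ x)) ℕ.+ altdesᶜ (not e) (y ∷ c)

punchIn-<ᶠ : ∀ (x : Fin (suc n)) (i j : Fin n) → punchIn x i <ᶠ punchIn x j ≡ i <ᶠ j
punchIn-<ᶠ zero    i       j       = refl
punchIn-<ᶠ (suc x) zero    zero    = refl
punchIn-<ᶠ (suc x) zero    (suc j) = refl
punchIn-<ᶠ (suc x) (suc i) zero    = refl
punchIn-<ᶠ (suc x) (suc i) (suc j) = punchIn-<ᶠ x i j

punchIn-<ᶠ-pivot : ∀ (x : Fin (suc n)) (i : Fin n) → punchIn x i <ᶠ x ≡ i <ᶠ x
punchIn-<ᶠ-pivot zero    i       = refl
punchIn-<ᶠ-pivot (suc x) zero    = refl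
punchIn-<ᶠ-pivot (suc x) (suc i) = punchIn-<ᶠ-pivot x i

pivot-<ᶠ-punchIn : ∀ (x : Fin (suc n)) (i : Fin n) → x <ᶠ punchIn x i ≡ not (i <ᶠ x)
pivot-<ᶠ-punchIn zero    i       = refl
pivot-<ᶠ-punchIn (suc x) zero    = refl
pivot-<ᶠ-punchIn (suc x) (suc i) = pivot-<ᶠ-punchIn x i

altdesFrom-punchIn : ∀ k (x : Fin (suc n)) (w : Vec (Fin n) m) →
  altdesFrom k (map toℕ (toList (Vec.map (punchIn x) w))) ≡ altdesFrom k (map toℕ (toList w))
altdesFrom-punchIn k x []          = refl
altdesFrom-punchIn k x (i ∷ [])    = refl
altdesFrom-punchIn k x (i ∷ j ∷ w) =
  cong₂ ℕ._+_ (cong toNat (cong₂ (if isEven k then_else_) (punchIn-<ᶠ x i j) (punchIn-<ᶠ x j i)))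
              (altdesFrom-punchIn (suc k) x (j ∷ w))

isEven-suc : ∀ k → isEven (suc k) ≡ not (isEven k)
isEven-suc zero          = refl
isEven-suc (suc zero)    = refl
isEven-suc (suc (suc k)) = isEven-suc k

altdesFrom-decode : ∀ k (c : Code n) → altdesFrom k (map toℕ (toList (decode c))) ≡ altdesᶜ (isEven k) c
altdesFrom-decode k []          = refl
altdesFrom-decode k (x ∷ [])    = refl
altdesFrom-decode k (x ∷ y ∷ c) = cong₂ ℕ._+_ (cong toNat (first-comparison (isEven k))) (begin
    altdesFrom (suc k) (map toℕ (toList (Vec.map (punchIn x) (decode (y ∷ c)))))
  ≡⟨ altdesFrom-punchIn (suc k) x (decode (y ∷ c)) ⟩
    altdesFrom (suc k) (map toℕ (toList (decode (y ∷ c))))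
  ≡⟨ altdesFrom-decode (suc k) (y ∷ c) ⟩
    altdesᶜ (isEven (suc k)) (y ∷ c)
  ≡⟨ cong (λ e → altdesᶜ e (y ∷ c)) (isEven-suc k) ⟩
    altdesᶜ (not (isEven k)) (y ∷ c)
  ∎)
  where
  open ≡-Reasoning
  first-comparison : ∀ e → (if e then x <ᶠ punchIn x y else punchIn x y <ᶠ x) ≡ e xor (y <ᶠ x)
  first-comparison true  = pivot-<ᶠ-punchIn x y
  first-comparison false = punchIn-<ᶠ-pivot x y

δ : ℤ → ℤ → ℤ
δ a b = if does (a ℤ.≟ b) then + 1 else + 0

∑code-cong : ∀ n {G H : Code n → ℤ} → (∀ c → G c ≡ H c) → ∑code n G ≡ ∑code n H
∑code-cong zero    G≗H = G≗H []
∑code-cong (suc n) G≗H = sum-cong-≗ (λ x → ∑code-cong n (G≗H ∘ (x ∷_)))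

Âᶜ : ℕ → ℤ → ℤ
Âᶜ n k = ∑code n (λ c → δ (+ altdesᶜ false c) k)

Ahat≡Âᶜ : ∀ n k → Ahat n k ≡ Âᶜ n k
Ahat≡Âᶜ n k = begin
    + length (filter (λ π → + altdes π ℤ.≟ k) (perms n))
  ≡⟨ length-filter (λ π → + altdes π ℤ.≟ k) (perms n) ⟩
    ∑ˡ (perms n) (λ π → δ (+ altdes π) k)
  ≡⟨ ∑ˡ-filter (λ w → UniqueDec.unique? _≟_ (toList w)) (words n n) (λ π → δ (+ altdes π) k) ⟩
    ∑ˡ (words n n) (λ w → if unique w then δ (+ altdes w) k else + 0)
  ≡⟨ ∑ˡ-words n n _ ⟩
    ∑ʷ n n (λ w → if unique w then δ (+ altdes w) k else + 0)
  ≡⟨ ∑-permutations n (λ π → δ (+ altdes π) k) ⟩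
    ∑code n (λ c → δ (+ altdes (decode c)) k)
  ≡⟨ ∑code-cong n (λ c → cong (λ a → δ (+ a) k) (altdesFrom-decode 1 c)) ⟩
    Âᶜ n k
  ∎
  where open ≡-Reasoning

∑code-distrib-+ : ∀ n (G H : Code n → ℤ) → ∑code n (λ c → G c + H c) ≡ ∑code n G + ∑code n H
∑code-distrib-+ zero    G H = refl
∑code-distrib-+ (suc n) G H =
  trans (sum-cong-≗ (λ x → ∑code-distrib-+ n (G ∘ (x ∷_)) (H ∘ (x ∷_))))
        (∑-distrib-+ (λ x → ∑code n (G ∘ (x ∷_))) (λ x → ∑code n (H ∘ (x ∷_))))

*-distribˡ-∑code : ∀ n a (G : Code n → ℤ) → a * ∑code n G ≡ ∑code n (λ c → a * G c)
*-distribˡ-∑code zero    a G = refl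
*-distribˡ-∑code (suc n) a G =
  trans (*-distribˡ-sum a (λ x → ∑code n (G ∘ (x ∷_))))
        (sum-cong-≗ (λ x → *-distribˡ-∑code n a (G ∘ (x ∷_))))

∑-∑code-comm : ∀ m n (G : Fin m → Code n → ℤ) →
               ∑[ j < m ] ∑code n (G j) ≡ ∑code n (λ c → ∑[ j < m ] G j c)
∑-∑code-comm m zero    G = refl
∑-∑code-comm m (suc n) G =
  trans (∑-comm (λ j x → ∑code n (G j ∘ (x ∷_))))
        (sum-cong-≗ (λ x → ∑-∑code-comm m n (λ j → G j ∘ (x ∷_))))

complement : Code n → Code n
complement []      = []
complement (x ∷ c) = opposite x ∷ complement c

∑-opposite : ∀ n (F : Fin n → ℤ) → ∑[ i < n ] F (opposite i) ≡ sum F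
∑-opposite zero    F = refl
∑-opposite (suc n) F = begin
    F (fromℕ n) + ∑[ i < n ] F (inject₁ (opposite i))
  ≡⟨ cong (_+_ (F (fromℕ n))) (∑-opposite n (F ∘ inject₁)) ⟩
    F (fromℕ n) + ∑[ i < n ] F (inject₁ i)
  ≡⟨ ℤ.+-comm (F (fromℕ n)) _ ⟩
    ∑[ i < n ] F (inject₁ i) + F (fromℕ n)
  ≡⟨ sum-init-last F ⟨
    sum F
  ∎
  where open ≡-Reasoning

∑code-complement : ∀ n (G : Code n → ℤ) → ∑code n (G ∘ complement) ≡ ∑code n G
∑code-complement zero    G = refl
∑code-complement (suc n) G =
  trans (sum-cong-≗ (λ x → ∑code-complement n (G ∘ (opposite x ∷_))))
        (∑-opposite (suc n) (λ y → ∑code n (G ∘ (y ∷_))))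

insert : (v : ∀ {n} → Fin (suc n)) (f : ∀ {n} → Fin n → Fin (suc n)) → Fin (suc n) → Code n → Code (suc n)
insert v f zero    c       = v ∷ complement c
insert v f (suc j) (x ∷ c) = f x ∷ insert v f j c

∑code-insert : (v : ∀ {n} → Fin (suc n)) (f : ∀ {n} → Fin n → Fin (suc n)) →
               (∀ {n} (F : Fin (suc n) → ℤ) → sum F ≡ F v + ∑[ i < n ] F (f i)) →
               ∀ n (G : Code (suc n) → ℤ) → ∑code (suc n) G ≡ ∑[ j < suc n ] ∑code n (G ∘ insert v f j)
∑code-insert v f split zero    G = split (λ x → G (x ∷ []))
∑code-insert v f split (suc n) G = begin
    ∑[ x < suc (suc n) ] ∑code (suc n) (G ∘ (x ∷_))
  ≡⟨ split (λ x → ∑code (suc n) (G ∘ (x ∷_))) ⟩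
    ∑code (suc n) (G ∘ (v ∷_)) + ∑[ x < suc n ] ∑code (suc n) (G ∘ (f x ∷_))
  ≡⟨ cong₂ _+_ (sym (∑code-complement (suc n) (G ∘ (v ∷_)))) tail-insertions ⟩
    ∑code (suc n) (G ∘ insert v f zero) + ∑[ j < suc n ] ∑code (suc n) (G ∘ insert v f (suc j))
  ∎
  where
  open ≡-Reasoning
  tail-insertions : ∑[ x < suc n ] ∑code (suc n) (G ∘ (f x ∷_))
                  ≡ ∑[ j < suc n ] ∑[ x < suc n ] ∑code n (λ c → G (f x ∷ insert v f j c))
  tail-insertions = trans (sum-cong-≗ (λ x → ∑code-insert v f split n (G ∘ (f x ∷_))))
                          (∑-comm (λ x j → ∑code n (λ c → G (f x ∷ insert v f j c))))

split-max : ∀ {n} (F : Fin (suc n) → ℤ) → sum F ≡ F (fromℕ n) + ∑[ i < n ] F (inject₁ i)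
split-max F = trans (sum-init-last F) (ℤ.+-comm _ (F (fromℕ _)))

split-min : ∀ {n} (F : Fin (suc n) → ℤ) → sum F ≡ F zero + ∑[ i < n ] F (suc i)
split-min F = refl

insertMax insertMin : Fin (suc n) → Code n → Code (suc n)
insertMax = insert (λ {n} → fromℕ n) inject₁
insertMin = insert zero suc

∑code-insertMax : ∀ n (G : Code (suc n) → ℤ) → ∑code (suc n) G ≡ ∑[ j < suc n ] ∑code n (G ∘ insertMax j)
∑code-insertMax = ∑code-insert (λ {n} → fromℕ n) inject₁ split-max

∑code-insertMin : ∀ n (G : Code (suc n) → ℤ) → ∑code (suc n) G ≡ ∑[ j < suc n ] ∑code n (G ∘ insertMin j)
∑code-insertMin = ∑code-insert zero suc split-min

fromℕ-<ᶠ : ∀ (i : Fin (suc n)) → fromℕ n <ᶠ i ≡ false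
fromℕ-<ᶠ {n = zero}  zero    = refl
fromℕ-<ᶠ {n = suc n} zero    = refl
fromℕ-<ᶠ {n = suc n} (suc i) = fromℕ-<ᶠ i

<ᶠ-fromℕ : ∀ (i : Fin (suc n)) → i <ᶠ fromℕ (suc n) ≡ true
<ᶠ-fromℕ             zero    = refl
<ᶠ-fromℕ {n = suc n} (suc i) = <ᶠ-fromℕ i

opposite-<ᶠ : ∀ (x : Fin (suc (suc n))) (y : Fin (suc n)) → opposite y <ᶠ opposite x ≡ not (y <ᶠ x)
opposite-<ᶠ             zero    y       = <ᶠ-fromℕ (opposite y)
opposite-<ᶠ             (suc x) zero    rewrite toℕ-inject₁ (opposite x) = fromℕ-<ᶠ (opposite x)
opposite-<ᶠ {n = suc n} (suc x) (suc y) rewrite toℕ-inject₁ (opposite x) | toℕ-inject₁ (opposite y) =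
  opposite-<ᶠ x y

altdesᶜ-complement : ∀ e (c : Code n) → altdesᶜ e (complement c) ≡ altdesᶜ (not e) c
altdesᶜ-complement e []          = refl
altdesᶜ-complement e (x ∷ [])    = refl
altdesᶜ-complement e (x ∷ y ∷ c) =
  cong₂ ℕ._+_ (cong toNat (begin
                  e xor (opposite y <ᶠ opposite x) ≡⟨ cong (e xor_) (opposite-<ᶠ x y) ⟩
                  e xor not (y <ᶠ x)               ≡⟨ not-distribʳ-xor e (y <ᶠ x) ⟨
                  not (e xor (y <ᶠ x))             ≡⟨ not-distribˡ-xor e (y <ᶠ x) ⟩
                  not e xor (y <ᶠ x)               ∎))
              (altdesᶜ-complement (not e) (y ∷ c))
  where open ≡-Reasoning

insertionPair : Bool → (ℕ → ℤ) → Fin (suc n) → Code n → ℤ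
insertionPair e F j c = F (altdesᶜ e (insertMax j c)) + F (altdesᶜ e (insertMin j c))

insertionPair-first : ∀ F (c : Code (suc n)) →
  insertionPair false F zero c ≡ F (suc (altdesᶜ false c)) + F (altdesᶜ false c)
insertionPair-first F (x ∷ c) rewrite <ᶠ-fromℕ (opposite x) | altdesᶜ-complement true (x ∷ c) = refl

insertionPair-second : ∀ e F (x : Fin (suc (suc n))) y (c : Code n) →
  insertionPair e F (suc zero) (x ∷ y ∷ c)
  ≡ F (altdesᶜ (not e) (y ∷ c)) + F (suc (suc (altdesᶜ (not e) (y ∷ c))))
insertionPair-second true  F x y c
  rewrite toℕ-inject₁ x | fromℕ-<ᶠ x | <ᶠ-fromℕ (opposite y) | altdesᶜ-complement true (y ∷ c) =
  ℤ.+-comm (F (suc (suc (altdesᶜ false (y ∷ c))))) (F (altdesᶜ false (y ∷ c)))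
insertionPair-second false F x y c
  rewrite toℕ-inject₁ x | fromℕ-<ᶠ x | <ᶠ-fromℕ (opposite y) | altdesᶜ-complement false (y ∷ c) = refl

insertionPair-shift : ∀ e F (x : Fin (suc (suc n))) y (c : Code n) j →
  insertionPair e F (suc (suc j)) (x ∷ y ∷ c)
  ≡ insertionPair (not e) (λ a → F (toNat (e xor (y <ᶠ x)) ℕ.+ a)) (suc j) (y ∷ c)
insertionPair-shift e F x y c j rewrite toℕ-inject₁ x | toℕ-inject₁ y = refl

-- The term F (pred a) has weight a, so its junk value at a = 0 does not matter.
laterProfile : (ℕ → ℤ) → ℕ → ℤ → ℤ
laterProfile F a N =
  + a * F (pred a) + (+ a + + 1) * F (suc a) + (N - + a) * F a + (N - + a - + 1) * F (suc (suc a))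

step-identity₀ : ∀ A N p f₀ f₁ f₂ →
  f₀ + f₂ + (A * p + (A + + 1) * f₁ + (N - A) * f₀ + (N - A - + 1) * f₂)
  ≡ A * p + (A + + 1) * f₁ + (+ 1 + N - A) * f₀ + (+ 1 + N - A - + 1) * f₂
step-identity₀ = solve-∀

step-identity₁ : ∀ A N f₀ f₁ f₂ f₃ →
  f₀ + f₂ + (A * f₀ + (A + + 1) * f₂ + (N - A) * f₁ + (N - A - + 1) * f₃)
  ≡ (+ 1 + A) * f₀ + (+ 1 + A + + 1) * f₂ + (+ 1 + N - (+ 1 + A)) * f₁ + (+ 1 + N - (+ 1 + A) - + 1) * f₃
step-identity₁ = solve-∀

laterProfile-step : ∀ b F a N →
  F a + F (suc (suc a)) + laterProfile (λ a′ → F (toNat b ℕ.+ a′)) a N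
  ≡ laterProfile F (toNat b ℕ.+ a) (+ 1 + N)
laterProfile-step false F a       N = step-identity₀ (+ a) N (F (pred a)) (F a) (F (suc a)) (F (suc (suc a)))
laterProfile-step true  F zero    N = step-identity₁ (+ 0) N (F 0) (F 1) (F 2) (F 3)
laterProfile-step true  F (suc a) N =
  step-identity₁ (+ suc a) N (F (suc a)) (F (suc (suc a))) (F (suc (suc (suc a)))) (F (suc (suc (suc (suc a)))))

∑-laterInsertions : ∀ e F (c : Code (suc n)) →
  ∑[ j < suc n ] insertionPair e F (suc j) c ≡ laterProfile F (altdesᶜ e c) (+ suc n)
∑-laterInsertions true  F (zero ∷ []) = one-letter (F 0) (F 1) (F 2)
  where
  one-letter : ∀ f₀ f₁ f₂ → f₁ + f₀ + + 0 ≡ + 0 * f₀ + (+ 0 + + 1) * f₁ + (+ 1 - + 0) * f₀ + (+ 1 - + 0 - + 1) * f₂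
  one-letter = solve-∀
∑-laterInsertions false F (zero ∷ []) = one-letter (F 0) (F 1) (F 2)
  where
  one-letter : ∀ f₀ f₁ f₂ → f₀ + f₁ + + 0 ≡ + 0 * f₀ + (+ 0 + + 1) * f₁ + (+ 1 - + 0) * f₀ + (+ 1 - + 0 - + 1) * f₂
  one-letter = solve-∀
∑-laterInsertions {n = suc n} e F (x ∷ y ∷ c) = begin
    insertionPair e F (suc zero) (x ∷ y ∷ c) + ∑[ j < suc n ] insertionPair e F (suc (suc j)) (x ∷ y ∷ c)
  ≡⟨ cong₂ _+_ (insertionPair-second e F x y c) (sum-cong-≗ (insertionPair-shift e F x y c)) ⟩
    F a + F (suc (suc a)) + ∑[ j < suc n ] insertionPair (not e) F′ (suc j) (y ∷ c)
  ≡⟨ cong (_+_ (F a + F (suc (suc a)))) (∑-laterInsertions (not e) F′ (y ∷ c)) ⟩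
    F a + F (suc (suc a)) + laterProfile F′ a (+ suc n)
  ≡⟨ laterProfile-step (e xor (y <ᶠ x)) F a (+ suc n) ⟩
    laterProfile F (altdesᶜ e (x ∷ y ∷ c)) (+ suc (suc n))
  ∎
  where
  open ≡-Reasoning
  a = altdesᶜ (not e) (y ∷ c)
  F′ = λ a′ → F (toNat (e xor (y <ᶠ x)) ℕ.+ a′)

∑-insertions : ∀ F (c : Code (suc n)) →
  ∑[ j < suc (suc n) ] insertionPair false F j c
  ≡ F (suc (altdesᶜ false c)) + F (altdesᶜ false c) + laterProfile F (altdesᶜ false c) (+ suc n)
∑-insertions F c = cong₂ _+_ (insertionPair-first F c) (∑-laterInsertions false F c)

δ-shift : ∀ c x y → δ (c + x) y ≡ δ x (y - c)
δ-shift c x y = cong (λ b → if b then + 1 else + 0) (does-⇔ (mk⇔ to from) (c + x ℤ.≟ y) (x ℤ.≟ y - c))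
  where
  cancel : ∀ c x → x ≡ c + x - c
  cancel = solve-∀
  uncancel : ∀ c y → c + (y - c) ≡ y
  uncancel = solve-∀
  to : c + x ≡ y → x ≡ y - c
  to eq = trans (cancel c x) (cong (_- c) eq)
  from : x ≡ y - c → c + x ≡ y
  from eq = trans (cong (_+_ c) eq) (uncancel c y)

*-δ : ∀ {a b} x y → (x ≡ y → a ≡ b) → a * δ x y ≡ b * δ x y
*-δ {a} {b} x y x≡y⇒a≡b with x ℤ.≟ y
... | yes x≡y = cong (_* + 1) (x≡y⇒a≡b x≡y)
... | no  _   = trans (ℤ.*-zeroʳ a) (sym (ℤ.*-zeroʳ b))

insertion-weights : ∀ a k N →
  δ (+ suc a) k + δ (+ a) k + laterProfile (λ b → δ (+ b) k) a N
  ≡ (k + + 1) * (δ (+ a) (k + + 1) + δ (+ a) (k - + 1)) + (N - k + + 1) * (δ (+ a) k + δ (+ a) (k - + 2))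
insertion-weights a k N = begin
    δ (+ suc a) k + δ (+ a) k + laterProfile (λ b → δ (+ b) k) a N
  ≡⟨ regroup (+ a) N (δ (+ pred a) k) (δ (+ suc a) k) (δ (+ a) k) (δ (+ suc (suc a)) k) ⟩
    + a * δ (+ pred a) k + (+ a + + 2) * δ (+ suc a) k
      + (N - + a + + 1) * δ (+ a) k + (N - + a - + 1) * δ (+ suc (suc a)) k
  ≡⟨ cong₂ _+_ (cong₂ _+_ (cong₂ _+_ (weight₋₁ a) weight₊₁) weight₀) weight₊₂ ⟩
    (k + + 1) * δ (+ a) (k + + 1) + (k + + 1) * δ (+ a) (k - + 1)
      + (N - k + + 1) * δ (+ a) k + (N - k + + 1) * δ (+ a) (k - + 2)
  ≡⟨ collect (k + + 1) (N - k + + 1) _ _ _ _ ⟩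
    (k + + 1) * (δ (+ a) (k + + 1) + δ (+ a) (k - + 1)) + (N - k + + 1) * (δ (+ a) k + δ (+ a) (k - + 2))
  ∎
  where
  open ≡-Reasoning
  regroup : ∀ A N p q r s → q + r + (A * p + (A + + 1) * q + (N - A) * r + (N - A - + 1) * s)
                            ≡ A * p + (A + + 2) * q + (N - A + + 1) * r + (N - A - + 1) * s
  regroup = solve-∀
  collect : ∀ α β p q r s → α * p + α * q + β * r + β * s ≡ α * (p + q) + β * (r + s)
  collect = solve-∀
  k+1-1 : ∀ k → k + + 1 - + 1 ≡ k
  k+1-1 = solve-∀
  k-1+2 : ∀ k → k - + 1 + + 2 ≡ k + + 1
  k-1+2 = solve-∀
  N-[k-2]-1 : ∀ N k → N - (k - + 2) - + 1 ≡ N - k + + 1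
  N-[k-2]-1 = solve-∀
  weight₋₁ : ∀ a → + a * δ (+ pred a) k ≡ (k + + 1) * δ (+ a) (k + + 1)
  weight₋₁ zero    = sym (*-δ (+ 0) (k + + 1) sym)
  weight₋₁ (suc a) = begin
      + suc a * δ (+ a) k
    ≡⟨ cong (_*_ (+ suc a)) (sym (trans (δ-shift (+ 1) (+ a) (k + + 1)) (cong (δ (+ a)) (k+1-1 k)))) ⟩
      + suc a * δ (+ suc a) (k + + 1)
    ≡⟨ *-δ (+ suc a) (k + + 1) (λ eq → eq) ⟩
      (k + + 1) * δ (+ suc a) (k + + 1)
    ∎
  weight₊₁ : (+ a + + 2) * δ (+ suc a) k ≡ (k + + 1) * δ (+ a) (k - + 1)
  weight₊₁ = trans (cong ((+ a + + 2) *_) (δ-shift (+ 1) (+ a) k))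
             (*-δ (+ a) (k - + 1) (λ eq → trans (cong (_+ + 2) eq) (k-1+2 k)))
  weight₀ : (N - + a + + 1) * δ (+ a) k ≡ (N - k + + 1) * δ (+ a) k
  weight₀ = *-δ (+ a) k (λ eq → cong (λ t → N - t + + 1) eq)
  weight₊₂ : (N - + a - + 1) * δ (+ suc (suc a)) k ≡ (N - k + + 1) * δ (+ a) (k - + 2)
  weight₊₂ = trans (cong ((N - + a - + 1) *_) (δ-shift (+ 2) (+ a) k))
                (*-δ (+ a) (k - + 2) (λ eq → trans (cong (λ t → N - t - + 1) eq) (N-[k-2]-1 N k)))

∑code-combination : ∀ n α β (P Q R S : Code n → ℤ) →
  ∑code n (λ c → α * (P c + Q c) + β * (R c + S c))
  ≡ α * (∑code n P + ∑code n Q) + β * (∑code n R + ∑code n S)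
∑code-combination n α β P Q R S = begin
    ∑code n (λ c → α * (P c + Q c) + β * (R c + S c))
  ≡⟨ ∑code-distrib-+ n (λ c → α * (P c + Q c)) (λ c → β * (R c + S c)) ⟩
    ∑code n (λ c → α * (P c + Q c)) + ∑code n (λ c → β * (R c + S c))
  ≡⟨ cong₂ _+_ (*-distribˡ-∑code n α (λ c → P c + Q c)) (*-distribˡ-∑code n β (λ c → R c + S c)) ⟨
    α * ∑code n (λ c → P c + Q c) + β * ∑code n (λ c → R c + S c)
  ≡⟨ cong₂ (λ u v → α * u + β * v) (∑code-distrib-+ n P Q) (∑code-distrib-+ n R S) ⟩
    α * (∑code n P + ∑code n Q) + β * (∑code n R + ∑code n S)
  ∎
  where open ≡-Reasoning

Âᶜ-recurrence : ∀ m k →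
  + 2 * Âᶜ (suc (suc m)) k
  ≡ (k + + 1) * (Âᶜ (suc m) (k + + 1) + Âᶜ (suc m) (k - + 1))
    + (+ suc m - k + + 1) * (Âᶜ (suc m) k + Âᶜ (suc m) (k - + 2))
Âᶜ-recurrence m k = begin
    + 2 * ∑code (suc len) G
  ≡⟨ double (∑code (suc len) G) ⟩
    ∑code (suc len) G + ∑code (suc len) G
  ≡⟨ cong₂ _+_ (∑code-insertMax len G) (∑code-insertMin len G) ⟩
    ∑[ j < suc len ] ∑code len (G ∘ insertMax j) + ∑[ j < suc len ] ∑code len (G ∘ insertMin j)
  ≡⟨ ∑-distrib-+ (λ j → ∑code len (G ∘ insertMax j)) (λ j → ∑code len (G ∘ insertMin j)) ⟨
    ∑[ j < suc len ] (∑code len (G ∘ insertMax j) + ∑code len (G ∘ insertMin j))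
  ≡⟨ sum-cong-≗ (λ j → ∑code-distrib-+ len (G ∘ insertMax j) (G ∘ insertMin j)) ⟨
    ∑[ j < suc len ] ∑code len (insertionPair false F j)
  ≡⟨ ∑-∑code-comm (suc len) len (insertionPair false F) ⟩
    ∑code len (λ c → ∑[ j < suc len ] insertionPair false F j c)
  ≡⟨ ∑code-cong len (λ c → trans (∑-insertions F c) (insertion-weights (altdesᶜ false c) k (+ len))) ⟩
    ∑code len (λ c → (k + + 1) * (G′ (k + + 1) c + G′ (k - + 1) c) + (+ len - k + + 1) * (G′ k c + G′ (k - + 2) c))
  ≡⟨ ∑code-combination len (k + + 1) (+ len - k + + 1) (G′ (k + + 1)) (G′ (k - + 1)) (G′ k) (G′ (k - + 2)) ⟩
    (k + + 1) * (Âᶜ len (k + + 1) + Âᶜ len (k - + 1)) + (+ len - k + + 1) * (Âᶜ len k + Âᶜ len (k - + 2))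
  ∎
  where
  open ≡-Reasoning
  len = suc m
  G′ : ℤ → Code n → ℤ
  G′ k′ c = δ (+ altdesᶜ false c) k′
  G : Code (suc len) → ℤ
  G = G′ k
  F : ℕ → ℤ
  F a = δ (+ a) k
  double : ∀ x → + 2 * x ≡ x + x
  double = solve-∀

theorem2p1 : ((n : ℕ) → 1 ≤ n → (k : ℤ) →
               + 2 * Ahat (suc n) k
                 ≡ (k + + 1) * (Ahat n (k + + 1) + Ahat n (k - + 1))
                   + (+ n - k + + 1) * (Ahat n k + Ahat n (k - + 2)))
             × (Ahat 1 (+ 0) ≡ + 1)
             × ((k : ℤ) → k ≢ + 0 → Ahat 1 k ≡ + 0)
theorem2p1 = recurrence , refl , vanishes
  where
  recurrence : (n : ℕ) → 1 ≤ n → (k : ℤ) →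
               + 2 * Ahat (suc n) k
                 ≡ (k + + 1) * (Ahat n (k + + 1) + Ahat n (k - + 1))
                   + (+ n - k + + 1) * (Ahat n k + Ahat n (k - + 2))
  recurrence (suc m) _ k = begin
      + 2 * Ahat (suc (suc m)) k
    ≡⟨ cong (_*_ (+ 2)) (Ahat≡Âᶜ (suc (suc m)) k) ⟩
      + 2 * Âᶜ (suc (suc m)) k
    ≡⟨ Âᶜ-recurrence m k ⟩
      (k + + 1) * (Âᶜ (suc m) (k + + 1) + Âᶜ (suc m) (k - + 1))
        + (+ suc m - k + + 1) * (Âᶜ (suc m) k + Âᶜ (suc m) (k - + 2))
    ≡⟨ cong₂ (λ u v → (k + + 1) * u + (+ suc m - k + + 1) * v)
             (cong₂ _+_ (Ahat≡Âᶜ (suc m) (k + + 1)) (Ahat≡Âᶜ (suc m) (k - + 1)))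
             (cong₂ _+_ (Ahat≡Âᶜ (suc m) k) (Ahat≡Âᶜ (suc m) (k - + 2))) ⟨
      (k + + 1) * (Ahat (suc m) (k + + 1) + Ahat (suc m) (k - + 1))
        + (+ suc m - k + + 1) * (Ahat (suc m) k + Ahat (suc m) (k - + 2))
    ∎
    where open ≡-Reasoning
  vanishes : (k : ℤ) → k ≢ + 0 → Ahat 1 k ≡ + 0
  vanishes k k≢0 = trans (Ahat≡Âᶜ 1 k)
    (cong (λ b → (if b then + 1 else + 0) + + 0) (dec-false (+ 0 ℤ.≟ k) (k≢0 ∘ sym)))
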